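{- Let $\mathbb{F}$ be a field with multiplicative group $\mathbb{F}^*$. Then every open face of every generalized grope over $\mathbb{F}^*$ can be excised over $\mathbb{F}^*$.
   Context: An integer $k>1$ is torsion-coprime over $\mathbb{F}^*$ if the equation $x^k=1$ has the unique solution $x=1$ in $\mathbb{F}^*$. Generalized gropes over $\mathbb{F}^*$ are $\Delta$-complexes (in the sense of Hatcher: triangles glued along edges and vertices, where edge endpoints need not be distinct and two faces may intersect in more than one simplex) defined inductively: a generalized grope of complexity $0$ is a $\Delta$-triangulated closed orientable surface; a generalized grope of complexity $q+1$ is obtained from a generalized grope of complexity $q$ by removing one open face $f$ and gluing in a $\Delta$-triangulated compact orientable surface $S$ whose boundary $\partial S$ is connected and has $3k$ vertices, where $k>1$ is torsion-coprime over $\mathbb{F}^*$, by identifying $\partial S$ with $\partial f$ via a simplicial covering map $\partial S\to\partial f$. A generalized grope over $\mathbb{F}^*$ is a generalized grope of complexity $q$ for some $q\ge 0$. Excision. Let $\vec E$ be the set of oriented edges of the complex ($ab$ oriented from $a$ to $b$). For a multiplicative group $G$, an open face $a_0b_0c_0$ can be excised over $G$ if every function $U\colon\vec E\to G$ satisfying (E) $U(ab)=U(ba)^{ -1}$ for every oriented edge and (F) $U(ab)U(bc)U(ca)=1$ for every face $abc\neq a_0b_0c_0$ also satisfies $U(a_0b_0)U(b_0c_0)U(c_0a_0)=1$. -}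

module Defs where

open import Level using (Level; _⊔_; 0ℓ) renaming (suc to lsuc)
open import Data.Nat as ℕ using (ℕ; zero; suc)
open import Data.Nat.DivMod using (_mod_)
open import Data.Fin as Fin using (Fin; zero; suc; toℕ)
open import Data.Fin.Properties using (any?)
open import Data.Bool as Bool using (Bool; true; false; not; if_then_else_)
open import Data.Product using (Σ; ∃; _×_; _,_; proj₁; proj₂)
open import Data.Sum using (_⊎_; inj₁; inj₂)
open import Relation.Nullary using (¬_; yes; no)
open import Relation.Binary.PropositionalEquality using (_≡_; _≢_)
open import Relation.Binary.Construct.Closure.ReflexiveTransitive using (Star)
open import Algebra.Bundles using (CommutativeRing)

record Field (c ℓ : Level) : Set (lsuc (c ⊔ ℓ)) where
  field
    commutativeRing : CommutativeRing c ℓ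
  open CommutativeRing commutativeRing public
  field
    1≉0     : ¬ (1# ≈ 0#)
    inverse : ∀ x → ¬ (x ≈ 0#) → Σ Carrier (λ y → (x * y) ≈ 1#)

module _ {c ℓ} (K : Field c ℓ) where
  open Field K using (Carrier; _≈_; _*_; 0#; 1#)

  pow : Carrier → ℕ → Carrier
  pow x zero    = 1#
  pow x (suc n) = x * pow x n

  TorsionCoprime : ℕ → Set (c ⊔ ℓ)
  TorsionCoprime k = (1 ℕ.< k) × (∀ x → ¬ (x ≈ 0#) → pow x k ≈ 1# → x ≈ 1#)

-- 2-dimensional complexes built from triangles glued along edges.
-- A face has three sides, each an oriented edge; side i runs from corner i
-- to corner i+1 (mod 3), so the sides read ab, bc, ca.

OE' : Set → Set
OE' E = E × Bool   -- (e , true) = e traversed src→tgt, (e , false) = tgt→src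

record Cx : Set₁ where
  field
    V E F : Set
    src tgt : E → V
    side : F → Fin 3 → OE' E

  OE : Set
  OE = OE' E

  s t : OE → V
  s (e , true)  = src e
  s (e , false) = tgt e
  t (e , true)  = tgt e
  t (e , false) = src e

  rev : OE → OE
  rev (e , b) = (e , not b)

next prev : Fin 3 → Fin 3
next zero = suc zero
next (suc zero) = suc (suc zero)
next (suc (suc zero)) = zero
prev zero = suc (suc zero)
prev (suc zero) = zero
prev (suc (suc zero)) = suc zero

cycSuc : ∀ {n} → Fin n → Fin n
cycSuc {suc n} i = suc (toℕ i) mod suc n

module _ {c ℓ} (K : Field c ℓ) (X : Cx) where
  open Field K using (Carrier; _≈_; _*_; 0#; 1#)
  open Cx X

  Excisable : F → Set (c ⊔ ℓ)
  Excisable f₀ =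
    (U : OE → Carrier) →
    (∀ a → ¬ (U a ≈ 0#)) →
    (∀ a → (U a * U (rev a)) ≈ 1#) →                -- (E) U(ab) = U(ba)⁻¹
    (∀ g → g ≢ f₀ →
       ((U (side g zero) * U (side g (suc zero))) * U (side g (suc (suc zero)))) ≈ 1#) →
    ((U (side f₀ zero) * U (side f₀ (suc zero))) * U (side f₀ (suc (suc zero)))) ≈ 1#

module _ (X : Cx) where
  open Cx X

  Side : Set
  Side = F × Fin 3

  sideOE : Side → OE
  sideOE (g , i) = side g i

  OnEdge : Side → E → Set
  OnEdge σ e = proj₁ (sideOE σ) ≡ e

  WellFormed : Set
  WellFormed = ∀ g i → t (side g i) ≡ s (side g (next i))

  ExactlyOneSide : E → Set
  ExactlyOneSide e = Σ Side λ σ → OnEdge σ e × (∀ τ → OnEdge τ e → τ ≡ σ)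

  ExactlyTwoSides : E → Set
  ExactlyTwoSides e = Σ Side λ σ → Σ Side λ τ → σ ≢ τ × OnEdge σ e × OnEdge τ e ×
                        (∀ ρ → OnEdge ρ e → (ρ ≡ σ) ⊎ (ρ ≡ τ))

  -- link of a vertex v: nodes are the oriented edges leaving v,
  -- arcs are the corners of faces at v
  LinkNode : V → Set
  LinkNode v = Σ OE λ a → s a ≡ v

  LinkArc : (v : V) → LinkNode v → LinkNode v → Set
  LinkArc v a b = Σ Side λ { (g , i) →
      (proj₁ a ≡ side g i × proj₁ b ≡ rev (side g (prev i)))
    ⊎ (proj₁ b ≡ side g i × proj₁ a ≡ rev (side g (prev i))) }

  LinkConnected : V → Set
  LinkConnected v = LinkNode v × (∀ a b → Star (LinkArc v) a b)

  Adjacent : V → V → Set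
  Adjacent v w = Σ E λ e → (src e ≡ v × tgt e ≡ w) ⊎ (src e ≡ w × tgt e ≡ v)

  Connected : Set
  Connected = V × (∀ v w → Star Adjacent v w)

  induced : (F → Bool) → Side → Bool
  induced ε (g , i) = if ε g then proj₂ (side g i) else not (proj₂ (side g i))

  Orientable : Set
  Orientable = Σ (F → Bool) λ ε → ∀ σ τ e → σ ≢ τ → OnEdge σ e → OnEdge τ e →
                 induced ε σ ≢ induced ε τ

  ClosedOrientableSurface : Set
  ClosedOrientableSurface =
    WellFormed × Connected × Orientable × (∀ e → ExactlyTwoSides e) × (∀ v → LinkConnected v)

  CompactOrientableSurface : Set
  CompactOrientableSurface =
    WellFormed × Connected × Orientable ×
    (∀ e → ExactlyOneSide e ⊎ ExactlyTwoSides e) × (∀ v → LinkConnected v)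

record FinCx : Set where
  field
    nV nE nF : ℕ
    src tgt : Fin nE → Fin nV
    side : Fin nF → Fin 3 → OE' (Fin nE)

toCx : FinCx → Cx
toCx S = record { V = Fin nV ; E = Fin nE ; F = Fin nF ; src = src ; tgt = tgt ; side = side }
  where open FinCx S

-- Boundary of S: a single cycle β₀ … β_{3k-1} of boundary edges with
-- 3k distinct vertices, together with a simplicial covering map
-- φ : ∂S → ∂f (vertices of ∂f = corners 0,1,2 of the face f).

record BoundaryCover (S : FinCx) (k : ℕ) : Set where
  open Cx (toCx S)
  field
    β       : Fin (3 ℕ.* k) → OE
    β-bd    : ∀ i → ExactlyOneSide (toCx S) (proj₁ (β i))
    β-all   : ∀ e → ExactlyOneSide (toCx S) e → Σ (Fin (3 ℕ.* k)) λ i → proj₁ (β i) ≡ e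
    β-chain : ∀ i → t (β i) ≡ s (β (cycSuc i))
    β-inj   : ∀ i j → s (β i) ≡ s (β j) → i ≡ j
    φ       : Fin (3 ℕ.* k) → Fin 3
    φ-cover : ∀ i → φ i ≢ φ (cycSuc i) × φ (cycSuc i) ≢ φ (cycSuc (cycSuc i)) ×
                    φ i ≢ φ (cycSuc (cycSuc i))

-- Gluing: remove the open face f of Y and glue in S along φ.

module Glue (Y : Cx) (f : Cx.F Y) (S : FinCx) (k : ℕ) (bc : BoundaryCover S k) where
  private
    module Y = Cx Y
    module S = Cx (toCx S)
  open BoundaryCover bc

  IsBdV : Fin (FinCx.nV S) → Set
  IsBdV v = ∃ λ i → S.s (β i) ≡ v

  IsBdE : Fin (FinCx.nE S) → Set
  IsBdE e = ∃ λ i → proj₁ (β i) ≡ e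

  IntV = Σ (Fin (FinCx.nV S)) λ v → ¬ IsBdV v
  IntE = Σ (Fin (FinCx.nE S)) λ e → ¬ IsBdE e

  corner : Fin 3 → Y.V
  corner j = Y.s (Y.side f j)

  -- image of the boundary edge β i: the side of f from corner φ i to corner φ (i+1)
  img : Fin (3 ℕ.* k) → Y.OE
  img i with φ (cycSuc i) Fin.≟ next (φ i)
  ... | yes _ = Y.side f (φ i)
  ... | no  _ = Y.rev (Y.side f (φ (cycSuc i)))

  V' E' F' : Set
  V' = Y.V ⊎ IntV
  E' = Y.E ⊎ IntE
  F' = (Σ Y.F λ g → g ≢ f) ⊎ Fin (FinCx.nF S)

  embV : Fin (FinCx.nV S) → V'
  embV v with any? (λ i → S.s (β i) Fin.≟ v)
  ... | yes (i , _) = inj₁ (corner (φ i))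
  ... | no  p       = inj₂ (v , p)

  liftY : Y.OE → OE' E'
  liftY (e , b) = (inj₁ e , b)

  orientAs : Bool → Bool → Y.OE → Y.OE
  orientAs b b' a with b Bool.≟ b'
  ... | yes _ = a
  ... | no  _ = Y.rev a

  embOE : S.OE → OE' E'
  embOE (e , b') with any? (λ i → proj₁ (β i) Fin.≟ e)
  ... | yes (i , _) = liftY (orientAs (proj₂ (β i)) b' (img i))
  ... | no  p       = (inj₂ (e , p) , b')

  src' tgt' : E' → V'
  src' (inj₁ e)       = inj₁ (Y.src e)
  src' (inj₂ (e , _)) = embV (S.src e)
  tgt' (inj₁ e)       = inj₁ (Y.tgt e)
  tgt' (inj₂ (e , _)) = embV (S.tgt e)

  side' : F' → Fin 3 → OE' E'
  side' (inj₁ (g , _)) i = liftY (Y.side g i)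
  side' (inj₂ h)       i = embOE (S.side h i)

  glued : Cx
  glued = record { V = V' ; E = E' ; F = F' ; src = src' ; tgt = tgt' ; side = side' }

data IsGrope {c ℓ} (K : Field c ℓ) : ℕ → Cx → Set (lsuc 0ℓ ⊔ c ⊔ ℓ) where
  base : (S : FinCx) → ClosedOrientableSurface (toCx S) → IsGrope K zero (toCx S)
  step : ∀ {q Y} → IsGrope K q Y → (f : Cx.F Y) →
         (S : FinCx) → CompactOrientableSurface (toCx S) →
         (k : ℕ) → TorsionCoprime K k → (bc : BoundaryCover S k) →
         IsGrope K (suc q) (Glue.glued Y f S k bc)

module Submission where

-- Read the face conditions multiplicatively. On an oriented surface S the
-- product of all faces, each read along its induced orientation, telescopes
-- to the product of U along the oriented boundary, since the two sides of
-- every interior edge cancel by (E) (a discrete Stokes formula). On a closed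
-- surface this is 1, so any single face condition follows from the others.
--
-- In a gluing step the boundary cycle of S maps onto ∂f without ever
-- backtracking, so it runs k times around ∂f in a constant direction; and the
-- induced orientation agrees with the cycle either everywhere or nowhere (test
-- Stokes over ℤ on coboundaries of vertex indicators). Hence the product of U
-- along ∂S is W^k or its inverse, where W is the product around f or its
-- inverse, and W ≠ 0. As k is torsion-coprime, W^k = 1 iff W = 1, so the faces
-- of S jointly hold iff the (removed) face f would hold in Y. Excising a face of
-- S then uses excision of f in Y; excising a face g of Y derives the condition
-- at f from the faces of S and applies excision of g in Y.

open import Level using (Level)
open import Algebra.Bundles using (CommutativeMonoid)
open import Data.Bool as Bool using (Bool; true; false; not)
import Data.Bool.Properties as Bool
open import Data.Empty using (⊥-elim)
open import Data.Fin as Fin using (Fin; zero; suc; toℕ; fromℕ; inject₁; punchIn)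
open import Data.Fin.Induction using (<-weakInduction)
open import Data.Fin.Properties as Fin
  using (suc-injective; 0≢1+n; toℕ-inject₁; toℕ-fromℕ<; punchInᵢ≢i; punchIn-injective; punchIn-punchOut)
open import Data.Fin.Relation.Unary.Top using (view; ‵fromℕ; ‵inject₁)
open import Data.Nat as ℕ using (ℕ; zero; suc)
open import Data.Nat.DivMod using (m<n⇒m%n≡m; n%n≡0)
open import Data.Nat.GeneralisedArithmetic using (fold)
import Data.Nat.Properties as ℕ
open import Data.Integer as ℤ using (ℤ)
import Data.Integer.Properties as ℤ
open import Data.Integer.Tactic.RingSolver using (solve-∀)
open import Data.Product using (∃; _×_; _,_; proj₁; proj₂)
open import Data.Sum using (_⊎_; inj₁; inj₂; [_,_]′)
open import Data.Sum.Properties using (inj₂-injective)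
open import Function using (_∘_; _⇔_; mk⇔; Equivalence)
open import Function.Properties.Equivalence using (⇔-setoid) renaming (trans to ⇔-trans)
open import Relation.Nullary using (¬_; Dec; yes; no; does; contradiction)
open import Relation.Nullary.Decidable using (does-⇔)
open import Relation.Binary.PropositionalEquality as ≡ using (_≡_; _≢_; refl; cong; cong₂; module ≡-Reasoning)

open import Defs

module MonoidSums {a ℓ} (M : CommutativeMonoid a ℓ) where
  open CommutativeMonoid M renaming (Carrier to C; refl to ≈-refl)
  open import Algebra.Properties.CommutativeMonoid.Sum M public
    using (sum; sum-cong-≋; sum-cong-≗; sum-replicate-zero; sum-remove; ∑-comm; ∑-distrib-+)
  open import Relation.Binary.Reasoning.Setoid setoid

  when : {P : Set} → Dec P → C → C
  when (yes _) x = x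
  when (no _)  _ = ε

  when-yes : {P : Set} {x : C} → P → (d : Dec P) → when d x ≈ x
  when-yes p (yes _) = ≈-refl
  when-yes p (no ¬p) = contradiction p ¬p

  when-≈ε : {P : Set} {x : C} → (P → x ≈ ε) → (d : Dec P) → when d x ≈ ε
  when-≈ε x≈ε (yes p) = x≈ε p
  when-≈ε x≈ε (no _)  = ≈-refl

  sum-≈ε : ∀ {n} {f : Fin n → C} → (∀ i → f i ≈ ε) → sum f ≈ ε
  sum-≈ε {n} f≈ε = trans (sum-cong-≋ f≈ε) (sum-replicate-zero n)

  sum-support₁ : ∀ {n} {f : Fin n → C} x → (∀ i → i ≢ x → f i ≈ ε) → sum f ≈ f x
  sum-support₁ {suc n} {f} x off = begin
    sum f                         ≈⟨ sum-remove f ⟩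
    f x ∙ sum (f ∘ punchIn x)     ≈⟨ ∙-congˡ (sum-≈ε (λ i → off _ (punchInᵢ≢i x i))) ⟩
    f x ∙ ε                       ≈⟨ identityʳ (f x) ⟩
    f x                           ∎

  sum-support₂ : ∀ {n} {f : Fin n → C} {x y} → x ≢ y →
                 (∀ i → i ≢ x → i ≢ y → f i ≈ ε) → sum f ≈ f x ∙ f y
  sum-support₂ {suc n} {f} {x} {y} x≢y off = trans (sum-remove f) (∙-congˡ rest)
    where
    y′ = Fin.punchOut x≢y
    rest : sum (f ∘ punchIn x) ≈ f y
    rest = trans (sum-support₁ y′ (λ i i≢y′ → off _ (punchInᵢ≢i x i)
                   (λ eq → i≢y′ (punchIn-injective x i y′ (≡.trans eq (≡.sym (punchIn-punchOut x≢y)))))))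
                 (reflexive (cong f (punchIn-punchOut x≢y)))

  ∑∑-support₁ : ∀ {m n} {g : Fin m → Fin n → C} x y →
                (∀ h j → (h , j) ≢ (x , y) → g h j ≈ ε) → sum (λ h → sum (g h)) ≈ g x y
  ∑∑-support₁ x y off =
    trans (sum-support₁ x (λ h h≢x → sum-≈ε (λ j → off h j (h≢x ∘ cong proj₁))))
          (sum-support₁ y (λ j j≢y → off x j (j≢y ∘ cong proj₂)))

  ∑∑-support₂ : ∀ {m n} {g : Fin m → Fin n → C} x y x′ y′ → (x , y) ≢ (x′ , y′) →
                (∀ h j → (h , j) ≢ (x , y) → (h , j) ≢ (x′ , y′) → g h j ≈ ε) →
                sum (λ h → sum (g h)) ≈ g x y ∙ g x′ y′
  ∑∑-support₂ x y x′ y′ ne off with x Fin.≟ x′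
  ... | yes refl =
    trans (sum-support₁ x (λ h h≢x → sum-≈ε (λ j → off h j (h≢x ∘ cong proj₁) (h≢x ∘ cong proj₁))))
          (sum-support₂ (ne ∘ cong (x ,_)) (λ j j≢y j≢y′ → off x j (j≢y ∘ cong proj₂) (j≢y′ ∘ cong proj₂)))
  ... | no x≢x′ =
    trans (sum-support₂ x≢x′ (λ h h≢x h≢x′ →
             sum-≈ε (λ j → off h j (h≢x ∘ cong proj₁) (h≢x′ ∘ cong proj₁))))
          (∙-cong (sum-support₁ y (λ j j≢y → off x j (j≢y ∘ cong proj₂) (x≢x′ ∘ cong proj₁)))
                  (sum-support₁ y′ (λ j j≢y′ →
                     off x′ j (x≢x′ ∘ ≡.sym ∘ cong proj₁) (j≢y′ ∘ cong proj₂))))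

  sum-fibres : ∀ {m n} (p : Fin m → Fin n) (f : Fin m → C) →
               sum f ≈ sum (λ e → sum (λ i → when (p i Fin.≟ e) (f i)))
  sum-fibres p f = trans (sum-cong-≋ (sym ∘ column)) (∑-comm (λ i e → when (p i Fin.≟ e) (f i)))
    where
    column : ∀ i → sum (λ e → when (p i Fin.≟ e) (f i)) ≈ f i
    column i = trans (sum-support₁ (p i) (λ e e≢pi →
                              when-≈ε (λ pi≡e → contradiction (≡.sym pi≡e) e≢pi) (p i Fin.≟ e)))
                     (when-yes refl (p i Fin.≟ p i))

  sum-reindex : ∀ {m n} (p : Fin m → Fin n) (H : Fin n → C) →
                (∀ i j → p i ≡ p j → i ≡ j) → (∀ e → (∃ λ i → p i ≡ e) ⊎ H e ≈ ε) →
                sum (H ∘ p) ≈ sum H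
  sum-reindex p H p-injective covers = trans (sum-fibres p (H ∘ p)) (sum-cong-≋ fibre)
    where
    fibre : ∀ e → sum (λ i → when (p i Fin.≟ e) (H (p i))) ≈ H e
    fibre e with covers e
    ... | inj₁ (i₀ , refl) =
      trans (sum-support₁ i₀ (λ i i≢i₀ →
               when-≈ε (λ pi≡e → contradiction (p-injective i i₀ pi≡e) i≢i₀) (p i Fin.≟ p i₀)))
            (when-yes refl (p i₀ Fin.≟ p i₀))
    ... | inj₂ He≈ε = trans (sum-≈ε (λ i → when-≈ε (λ { refl → He≈ε }) (p i Fin.≟ e))) (sym He≈ε)

  inverse⇒≈ε⇔ : ∀ {x y} → x ∙ y ≈ ε → (x ≈ ε ⇔ y ≈ ε)
  inverse⇒≈ε⇔ {x} {y} xy≈ε = mk⇔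
    (λ x≈ε → trans (sym (identityˡ y)) (trans (∙-congʳ (sym x≈ε)) xy≈ε))
    (λ y≈ε → trans (sym (identityʳ x)) (trans (∙-congˡ (sym y≈ε)) xy≈ε))

  ≈⇒≈ε⇔ : ∀ {x y} → x ≈ y → (x ≈ ε ⇔ y ≈ ε)
  ≈⇒≈ε⇔ x≈y = mk⇔ (trans (sym x≈y)) (trans x≈y)

module _ {n : ℕ} where

  toℕ-cycSuc : (i : Fin (suc n)) → toℕ (cycSuc i) ≡ suc (toℕ i) ℕ.% suc n
  toℕ-cycSuc i = toℕ-fromℕ< _

  cycSuc-fromℕ : cycSuc (fromℕ n) ≡ zero
  cycSuc-fromℕ = Fin.toℕ-injective (begin
    toℕ (cycSuc (fromℕ n))     ≡⟨ toℕ-cycSuc (fromℕ n) ⟩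
    suc (toℕ (fromℕ n)) ℕ.% suc n ≡⟨ cong (λ m → suc m ℕ.% suc n) (Fin.toℕ-fromℕ n) ⟩
    suc n ℕ.% suc n            ≡⟨ n%n≡0 (suc n) ⟩
    0                          ∎)
    where open ≡-Reasoning

  cycSuc-inject₁ : (i : Fin n) → cycSuc (inject₁ i) ≡ suc i
  cycSuc-inject₁ i = Fin.toℕ-injective (begin
    toℕ (cycSuc (inject₁ i))         ≡⟨ toℕ-cycSuc (inject₁ i) ⟩
    suc (toℕ (inject₁ i)) ℕ.% suc n  ≡⟨ m<n⇒m%n≡m (ℕ.s≤s (Fin.inject₁ℕ< i)) ⟩
    suc (toℕ (inject₁ i))            ≡⟨ cong suc (toℕ-inject₁ i) ⟩
    suc (toℕ i)                      ∎)
    where open ≡-Reasoning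

  cycSuc-injective : ∀ {i j : Fin (suc n)} → cycSuc i ≡ cycSuc j → i ≡ j
  cycSuc-injective {i} {j} eq with view i | view j
  ... | ‵fromℕ     | ‵fromℕ     = refl
  ... | ‵fromℕ     | ‵inject₁ b =
    contradiction (≡.trans (≡.sym cycSuc-fromℕ) (≡.trans eq (cycSuc-inject₁ b))) 0≢1+n
  ... | ‵inject₁ a | ‵fromℕ     =
    contradiction (≡.trans (≡.sym cycSuc-fromℕ) (≡.trans (≡.sym eq) (cycSuc-inject₁ a))) 0≢1+n
  ... | ‵inject₁ a | ‵inject₁ b =
    cong inject₁ (suc-injective (≡.trans (≡.sym (cycSuc-inject₁ a)) (≡.trans eq (cycSuc-inject₁ b))))

  cycSuc-walk : {A : Set} (st : A → A) (w : Fin (suc n) → A) →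
                (∀ i → w (cycSuc i) ≡ st (w i)) → ∀ i → w i ≡ fold (w zero) st (toℕ i)
  cycSuc-walk st w w-step = <-weakInduction (λ i → w i ≡ fold (w zero) st (toℕ i)) refl extend
    where
    open ≡-Reasoning
    extend : ∀ j → w (inject₁ j) ≡ fold (w zero) st (toℕ (inject₁ j)) →
           w (suc j) ≡ fold (w zero) st (toℕ (suc j))
    extend j ih = begin
      w (suc j)                               ≡⟨ cong w (≡.sym (cycSuc-inject₁ j)) ⟩
      w (cycSuc (inject₁ j))                  ≡⟨ w-step (inject₁ j) ⟩
      st (w (inject₁ j))                      ≡⟨ cong st ih ⟩
      st (fold (w zero) st (toℕ (inject₁ j))) ≡⟨ cong (st ∘ fold (w zero) st) (toℕ-inject₁ j) ⟩
      st (fold (w zero) st (toℕ j))           ∎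

  cycSuc-invariant⇒constant : {A : Set} (c : Fin (suc n) → A) →
                              (∀ i → c (cycSuc i) ≡ c i) → ∀ i → c i ≡ c zero
  cycSuc-invariant⇒constant c c-step = <-weakInduction (λ i → c i ≡ c zero) refl
    (λ j ih → ≡.trans (cong c (≡.sym (cycSuc-inject₁ j))) (≡.trans (c-step (inject₁ j)) ih))

cycSuc-≢ : ∀ {n} → 1 ℕ.≤ n → (i : Fin (suc n)) → cycSuc i ≢ i
cycSuc-≢ {suc n} (ℕ.s≤s _) i eq with view i
... | ‵fromℕ     = 0≢1+n (≡.trans (≡.sym cycSuc-fromℕ) eq)
... | ‵inject₁ a = ℕ.1+n≢n (begin
  suc (toℕ a)          ≡⟨ cong toℕ (≡.trans (≡.sym (cycSuc-inject₁ a)) eq) ⟩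
  toℕ (inject₁ a)      ≡⟨ toℕ-inject₁ a ⟩
  toℕ a                ∎)
  where open ≡-Reasoning

cycSuc²-≢ : ∀ {n} → 2 ℕ.≤ n → (i : Fin (suc n)) → cycSuc (cycSuc i) ≢ i
cycSuc²-≢ {suc (suc n)} (ℕ.s≤s (ℕ.s≤s _)) i eq with view i
... | ‵fromℕ with () ← ≡.trans (≡.sym (≡.trans (cong cycSuc cycSuc-fromℕ) (cycSuc-inject₁ zero))) eq
... | ‵inject₁ a with view a
...   | ‵fromℕ with () ← ≡.trans (≡.sym (≡.trans (cong cycSuc (cycSuc-inject₁ a)) cycSuc-fromℕ)) eq
...   | ‵inject₁ b = ℕ.m≢1+n+m (toℕ b) {1} (≡.sym (begin
  suc (suc (toℕ b))             ≡⟨ cong toℕ (≡.trans (≡.sym twice) eq) ⟩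
  toℕ (inject₁ (inject₁ b))     ≡⟨ toℕ-inject₁ (inject₁ b) ⟩
  toℕ (inject₁ b)               ≡⟨ toℕ-inject₁ b ⟩
  toℕ b                         ∎))
  where
  open ≡-Reasoning
  twice : cycSuc (cycSuc (inject₁ (inject₁ b))) ≡ suc (suc b)
  twice = ≡.trans (cong cycSuc (cycSuc-inject₁ (inject₁ b))) (cycSuc-inject₁ (suc b))

turn : Bool → Fin 3 → Fin 3
turn true  = next
turn false = prev

turn³ : ∀ d a → turn d (turn d (turn d a)) ≡ a
turn³ true  zero             = refl
turn³ true  (suc zero)       = refl
turn³ true  (suc (suc zero)) = refl
turn³ false zero             = refl
turn³ false (suc zero)       = refl
turn³ false (suc (suc zero)) = refl

prev-next : ∀ a → prev (next a) ≡ a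
prev-next zero             = refl
prev-next (suc zero)       = refl
prev-next (suc (suc zero)) = refl

next-prev : ∀ a → next (prev a) ≡ a
next-prev zero             = refl
next-prev (suc zero)       = refl
next-prev (suc (suc zero)) = refl

≢⇒next⊎prev : ∀ {a b} → a ≢ b → b ≡ next a ⊎ b ≡ prev a
≢⇒next⊎prev {zero}             {zero}             a≢b = contradiction refl a≢b
≢⇒next⊎prev {zero}             {suc zero}         _   = inj₁ refl
≢⇒next⊎prev {zero}             {suc (suc zero)}   _   = inj₂ refl
≢⇒next⊎prev {suc zero}         {zero}             _   = inj₂ refl
≢⇒next⊎prev {suc zero}         {suc zero}         a≢b = contradiction refl a≢b
≢⇒next⊎prev {suc zero}         {suc (suc zero)}   _   = inj₁ refl
≢⇒next⊎prev {suc (suc zero)}   {zero}             _   = inj₁ refl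
≢⇒next⊎prev {suc (suc zero)}   {suc zero}         _   = inj₂ refl
≢⇒next⊎prev {suc (suc zero)}   {suc (suc zero)}   a≢b = contradiction refl a≢b

≢⇒turn : ∀ {a b} → a ≢ b → b ≡ turn (does (b Fin.≟ next a)) a
≢⇒turn {a} {b} a≢b with b Fin.≟ next a | ≢⇒next⊎prev a≢b
... | yes b≡next | _          = b≡next
... | no b≢next  | inj₁ b≡next = contradiction b≡next b≢next
... | no _       | inj₂ b≡prev = b≡prev

turn-consistent : ∀ {a b c} → a ≢ b → b ≢ c → a ≢ c → (b ≡ next a ⇔ c ≡ next b)
turn-consistent {a} {b} {c} a≢b b≢c a≢c = mk⇔ forwards backwards
  where
  forwards : b ≡ next a → c ≡ next b
  forwards refl with ≢⇒next⊎prev b≢c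
  ... | inj₁ c≡next = c≡next
  ... | inj₂ c≡prev = contradiction (≡.sym (≡.trans c≡prev (prev-next a))) a≢c
  backwards : c ≡ next b → b ≡ next a
  backwards refl with ≢⇒next⊎prev a≢b
  ... | inj₁ b≡next = b≡next
  ... | inj₂ refl   = contradiction (≡.sym (next-prev a)) a≢c

module CoveringDirection {n} (φ : Fin (suc n) → Fin 3)
  (φ-cover : ∀ i → φ i ≢ φ (cycSuc i) × φ (cycSuc i) ≢ φ (cycSuc (cycSuc i)) × φ i ≢ φ (cycSuc (cycSuc i)))
  where

  direction : Fin (suc n) → Bool
  direction i = does (φ (cycSuc i) Fin.≟ next (φ i))

  direction-constant : ∀ i → direction i ≡ direction zero
  direction-constant = cycSuc-invariant⇒constant direction λ i →
    let (a≢b , b≢c , a≢c) = φ-cover i in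
    ≡.sym (does-⇔ (turn-consistent a≢b b≢c a≢c) (φ (cycSuc i) Fin.≟ next (φ i))
                                                     (φ (cycSuc (cycSuc i)) Fin.≟ next (φ (cycSuc i))))

  φ-turn : ∀ i → φ (cycSuc i) ≡ turn (direction zero) (φ i)
  φ-turn i = ≡.trans (≢⇒turn (proj₁ (φ-cover i))) (cong (λ d → turn d (φ i)) (direction-constant i))

module OrientedEdges (X : Cx) where
  open Cx X

  rev-involutive : ∀ a → rev (rev a) ≡ a
  rev-involutive (e , b) = cong (e ,_) (Bool.not-involutive b)

  s-rev : ∀ a → s (rev a) ≡ t a
  s-rev (e , true)  = refl
  s-rev (e , false) = refl

  t-rev : ∀ a → t (rev a) ≡ s a
  t-rev (e , true)  = refl
  t-rev (e , false) = refl

  same-edge-endpoints : ∀ a b → proj₁ a ≡ proj₁ b → s a ≡ s b ⊎ (s a ≡ t b × t a ≡ s b)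
  same-edge-endpoints (e , true)  (.e , true)  refl = inj₁ refl
  same-edge-endpoints (e , true)  (.e , false) refl = inj₂ (refl , refl)
  same-edge-endpoints (e , false) (.e , true)  refl = inj₂ (refl , refl)
  same-edge-endpoints (e , false) (.e , false) refl = inj₁ refl

  reorient : Bool → OE → OE
  reorient true  a = a
  reorient false a = rev a

  -- the side of the face g leaving its corner a forwards (true) or backwards (false)
  sideFrom : F → Bool → Fin 3 → OE
  sideFrom g true  a = side g a
  sideFrom g false a = rev (side g (prev a))

  reorient-toward : ∀ e b d → (e , d) ≡ reorient (does (b Bool.≟ d)) (e , b)
  reorient-toward e b d with b Bool.≟ d
  ... | yes refl = refl
  ... | no b≢d   = cong (e ,_) (Bool.¬-not (b≢d ∘ ≡.sym))

module Cochain {a ℓ} (M : CommutativeMonoid a ℓ) (X : Cx) (u : Cx.OE X → CommutativeMonoid.Carrier M)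
  (u-rev : ∀ x → CommutativeMonoid._≈_ M (CommutativeMonoid._∙_ M (u x) (u (Cx.rev X x)))
                                         (CommutativeMonoid.ε M))
  where
  open CommutativeMonoid M renaming (Carrier to C; refl to ≈-refl)
  open MonoidSums M
  open import Algebra.Solver.CommutativeMonoid M using (solve; _⊕_; _⊜_; id)
  open import Relation.Binary.Reasoning.Setoid setoid
  open Cx X
  open OrientedEdges X

  faceProduct : F → C
  faceProduct g = (u (side g zero) ∙ u (side g (suc zero))) ∙ u (side g (suc (suc zero)))

  faceProduct-cong : ∀ {g h} → (∀ i → side g i ≡ side h i) → faceProduct g ≡ faceProduct h
  faceProduct-cong same =
    cong₂ _∙_ (cong₂ _∙_ (cong u (same zero)) (cong u (same (suc zero)))) (cong u (same (suc (suc zero))))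

  sum-reorient≈ε⇔ : ∀ b {n} (a : Fin n → OE) → (sum (u ∘ reorient b ∘ a) ≈ ε ⇔ sum (u ∘ a) ≈ ε)
  sum-reorient≈ε⇔ true  a = ≈⇒≈ε⇔ ≈-refl
  sum-reorient≈ε⇔ false a = inverse⇒≈ε⇔ (begin
    sum (u ∘ rev ∘ a) ∙ sum (u ∘ a)      ≈⟨ ∑-distrib-+ (u ∘ rev ∘ a) (u ∘ a) ⟨
    sum (λ i → u (rev (a i)) ∙ u (a i))  ≈⟨ sum-≈ε (λ i → trans (comm _ _) (u-rev (a i))) ⟩
    ε                                    ∎)

  sum-sideFrom≈ε⇔ : ∀ g d → (sum (u ∘ sideFrom g d) ≈ ε ⇔ faceProduct g ≈ ε)
  sum-sideFrom≈ε⇔ g true  = ≈⇒≈ε⇔ (solve 3 (λ x y z → x ⊕ (y ⊕ (z ⊕ id)) ⊜ (x ⊕ y) ⊕ z) ≈-refl _ _ _)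
  sum-sideFrom≈ε⇔ g false = inverse⇒≈ε⇔ (begin
    (r₂ ∙ (r₀ ∙ (r₁ ∙ ε))) ∙ ((x₀ ∙ x₁) ∙ x₂)  ≈⟨ solve 6 (λ x₀ x₁ x₂ r₀ r₁ r₂ →
                                                    (r₂ ⊕ (r₀ ⊕ (r₁ ⊕ id))) ⊕ ((x₀ ⊕ x₁) ⊕ x₂) ⊜
                                                    (x₀ ⊕ r₀) ⊕ ((x₁ ⊕ r₁) ⊕ (x₂ ⊕ r₂)))
                                                  ≈-refl x₀ x₁ x₂ r₀ r₁ r₂ ⟩
    (x₀ ∙ r₀) ∙ ((x₁ ∙ r₁) ∙ (x₂ ∙ r₂))        ≈⟨ ∙-cong (u-rev _) (∙-cong (u-rev _) (u-rev _)) ⟩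
    ε ∙ (ε ∙ ε)                                ≈⟨ trans (identityˡ _) (identityˡ ε) ⟩
    ε                                          ∎)
    where
    x₀ = u (side g zero)
    x₁ = u (side g (suc zero))
    x₂ = u (side g (suc (suc zero)))
    r₀ = u (rev (side g zero))
    r₁ = u (rev (side g (suc zero)))
    r₂ = u (rev (side g (suc (suc zero))))

signed : Bool → ℤ → ℤ
signed true  x = x
signed false x = ℤ.- x

signed-cancel : ∀ b c → signed b (ℤ.+ 1) ℤ.+ signed c (ℤ.- ℤ.+ 1) ≡ ℤ.+ 0 → b ≡ c
signed-cancel true  true  _ = refl
signed-cancel false false _ = refl

module Coboundary (X : Cx) (φ : Cx.V X → ℤ) where
  open Cx X
  open OrientedEdges X

  coboundary : OE → ℤ
  coboundary a = φ (t a) ℤ.- φ (s a)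

  coboundary-rev : ∀ a → coboundary a ℤ.+ coboundary (rev a) ≡ ℤ.+ 0
  coboundary-rev a rewrite s-rev a | t-rev a = cancel (φ (t a)) (φ (s a))
    where
    cancel : ∀ x y → (x ℤ.- y) ℤ.+ (y ℤ.- x) ≡ ℤ.+ 0
    cancel = solve-∀

  coboundary-reorient : ∀ b a → coboundary (reorient b a) ≡ signed b (coboundary a)
  coboundary-reorient true  a = refl
  coboundary-reorient false a rewrite s-rev a | t-rev a = swap (φ (t a)) (φ (s a))
    where
    swap : ∀ x y → y ℤ.- x ≡ ℤ.- (x ℤ.- y)
    swap = solve-∀

  coboundary-face : WellFormed X → ∀ g →
    (coboundary (side g zero) ℤ.+ coboundary (side g (suc zero))) ℤ.+ coboundary (side g (suc (suc zero))) ≡ ℤ.+ 0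
  coboundary-face wf g
    rewrite wf g zero | wf g (suc zero) | wf g (suc (suc zero)) =
      telescope (φ (s (side g zero))) (φ (s (side g (suc zero)))) (φ (s (side g (suc (suc zero)))))
    where
    telescope : ∀ x y z → ((y ℤ.- x) ℤ.+ (z ℤ.- y)) ℤ.+ (x ℤ.- z) ≡ ℤ.+ 0
    telescope = solve-∀

module BoundaryCycle (S : FinCx) {k : ℕ} (bc : BoundaryCover S (suc k)) where
  open Cx (toCx S)
  open OrientedEdges (toCx S)
  open BoundaryCover bc

  private
    2≤pred-length : 2 ℕ.≤ ℕ.pred (3 ℕ.* suc k)
    2≤pred-length = ℕ.≤-trans (ℕ.s≤s (ℕ.≤-trans (ℕ.s≤s ℕ.z≤n) (ℕ.m≤n+m _ k))) (ℕ.m≤n+m _ k)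

  cycSuc≢id : (i : Fin (3 ℕ.* suc k)) → cycSuc i ≢ i
  cycSuc≢id = cycSuc-≢ (ℕ.≤-trans (ℕ.s≤s ℕ.z≤n) 2≤pred-length)

  cycSuc²≢id : (i : Fin (3 ℕ.* suc k)) → cycSuc (cycSuc i) ≢ i
  cycSuc²≢id = cycSuc²-≢ 2≤pred-length

  -- An edge traversed twice in opposite directions would force i = i + 2 on a cycle of length ≥ 3.
  β-edge-injective : ∀ i j → proj₁ (β i) ≡ proj₁ (β j) → i ≡ j
  β-edge-injective i j same with same-edge-endpoints (β i) (β j) same
  ... | inj₁ same-start = β-inj i j same-start
  ... | inj₂ (sᵢ≡tⱼ , tᵢ≡sⱼ) = contradiction (≡.trans (cong cycSuc i→j) j→i) (cycSuc²≢id i)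
    where
    i→j : cycSuc i ≡ j
    i→j = β-inj (cycSuc i) j (≡.trans (≡.sym (β-chain i)) tᵢ≡sⱼ)
    j→i : cycSuc j ≡ i
    j→i = ≡.sym (β-inj i (cycSuc j) (≡.trans sᵢ≡tⱼ (β-chain j)))

  boundarySide : Fin (3 ℕ.* suc k) → Side (toCx S)
  boundarySide i = proj₁ (β-bd i)

module OrientedSurface (S : FinCx) (o : Orientable (toCx S)) where
  open FinCx S using (nE; nF)
  open Cx (toCx S)
  open OrientedEdges (toCx S)

  inducedOE : Side (toCx S) → OE
  inducedOE σ = proj₁ (sideOE (toCx S) σ) , induced (toCx S) (proj₁ o) σ

  inducedOE-reorient : ∀ h j → inducedOE (h , j) ≡ reorient (proj₁ o h) (side h j)
  inducedOE-reorient h j with proj₁ o h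
  ... | true  = refl
  ... | false = refl

  inducedOE-opposite : ∀ {σ τ e} → σ ≢ τ → OnEdge (toCx S) σ e → OnEdge (toCx S) τ e →
                       inducedOE σ ≡ rev (inducedOE τ)
  inducedOE-opposite σ≢τ σ-on τ-on =
    cong₂ _,_ (≡.trans σ-on (≡.sym τ-on)) (Bool.¬-not (proj₂ o _ _ _ σ≢τ σ-on τ-on))

  module Flux {a ℓ} (M : CommutativeMonoid a ℓ) (u : OE → CommutativeMonoid.Carrier M)
    (u-rev : ∀ x → CommutativeMonoid._≈_ M (CommutativeMonoid._∙_ M (u x) (u (rev x)))
                                           (CommutativeMonoid.ε M))
    where
    open CommutativeMonoid M renaming (Carrier to C; refl to ≈-refl)
    open MonoidSums M
    open Cochain M (toCx S) u u-rev public using (faceProduct)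
    open Cochain M (toCx S) u u-rev using (sum-reorient≈ε⇔; sum-sideFrom≈ε⇔)

    faceFlux : Fin nF → C
    faceFlux h = sum (λ j → u (inducedOE (h , j)))

    faceFlux≈ε⇔faceProduct≈ε : ∀ h → (faceFlux h ≈ ε ⇔ faceProduct h ≈ ε)
    faceFlux≈ε⇔faceProduct≈ε h =
      ⇔-trans (≈⇒≈ε⇔ (reflexive (sum-cong-≗ (cong u ∘ inducedOE-reorient h))))
              (⇔-trans (sum-reorient≈ε⇔ (proj₁ o h) (side h)) (sum-sideFrom≈ε⇔ h true))

    edgeFlux : ∀ {e} → ExactlyOneSide (toCx S) e ⊎ ExactlyTwoSides (toCx S) e → C
    edgeFlux (inj₁ (σ , _)) = u (inducedOE σ)
    edgeFlux (inj₂ _)       = ε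

    -- Stokes: each side of a face is counted once on its edge; the two sides of an
    -- interior edge carry opposite induced orientations and cancel.
    ∑faceFlux≈∑edgeFlux : (bd : ∀ e → ExactlyOneSide (toCx S) e ⊎ ExactlyTwoSides (toCx S) e) →
                          sum faceFlux ≈ sum (λ e → edgeFlux (bd e))
    ∑faceFlux≈∑edgeFlux bd = begin
      sum faceFlux                                 ≈⟨ sum-cong-≋ (λ h → sum-fibres (edge h) (flux h)) ⟩
      sum (λ h → sum (λ e → sum (λ j → term e h j))) ≈⟨ ∑-comm (λ h e → sum (λ j → term e h j)) ⟩
      sum (λ e → sum (λ h → sum (term e h)))         ≈⟨ sum-cong-≋ (λ e → onEdge e (bd e)) ⟩
      sum (λ e → edgeFlux (bd e))                    ∎
      where
      open import Relation.Binary.Reasoning.Setoid setoid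
      edge : Fin nF → Fin 3 → Fin nE
      edge h j = proj₁ (side h j)
      flux : Fin nF → Fin 3 → C
      flux h j = u (inducedOE (h , j))
      on? : ∀ e h j → Dec (edge h j ≡ e)
      on? e h j = edge h j Fin.≟ e
      term : Fin nE → Fin nF → Fin 3 → C
      term e h j = when (on? e h j) (flux h j)
      onEdge : ∀ e (r : ExactlyOneSide (toCx S) e ⊎ ExactlyTwoSides (toCx S) e) →
               sum (λ h → sum (term e h)) ≈ edgeFlux r
      onEdge e (inj₁ ((h₀ , j₀) , on₀ , unique)) =
        trans (∑∑-support₁ {g = term e} h₀ j₀ (λ h j ≢σ →
                 when-≈ε (λ on → contradiction (unique (h , j) on) ≢σ) (on? e h j)))
              (when-yes on₀ (on? e h₀ j₀))
      onEdge e (inj₂ ((h₀ , j₀) , (h₁ , j₁) , σ≢τ , on₀ , on₁ , covers)) = begin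
        sum (λ h → sum (term e h))
          ≈⟨ ∑∑-support₂ {g = term e} h₀ j₀ h₁ j₁ σ≢τ (λ h j ≢σ ≢τ →
               when-≈ε (λ on → ⊥-elim ([ ≢σ , ≢τ ]′ (covers (h , j) on))) (on? e h j)) ⟩
        term e h₀ j₀ ∙ term e h₁ j₁
          ≈⟨ ∙-cong (when-yes on₀ (on? e h₀ j₀)) (when-yes on₁ (on? e h₁ j₁)) ⟩
        flux h₀ j₀ ∙ flux h₁ j₁
          ≈⟨ ∙-congʳ (reflexive (cong u (inducedOE-opposite σ≢τ on₀ on₁))) ⟩
        u (rev (inducedOE (h₁ , j₁))) ∙ flux h₁ j₁
          ≈⟨ comm _ _ ⟩
        flux h₁ j₁ ∙ u (rev (inducedOE (h₁ , j₁)))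
          ≈⟨ u-rev _ ⟩
        ε ∎

    faceProduct≈ε-from-others : ∀ h₀ → sum faceFlux ≈ ε → (∀ h → h ≢ h₀ → faceProduct h ≈ ε) →
                                faceProduct h₀ ≈ ε
    faceProduct≈ε-from-others h₀ total others = Equivalence.to (faceFlux≈ε⇔faceProduct≈ε h₀)
      (trans (sym (sum-support₁ h₀ (λ h → Equivalence.from (faceFlux≈ε⇔faceProduct≈ε h) ∘ others h))) total)

    ∑faceFlux≈ε-from-faces : (∀ h → faceProduct h ≈ ε) → sum faceFlux ≈ ε
    ∑faceFlux≈ε-from-faces faces = sum-≈ε (λ h → Equivalence.from (faceFlux≈ε⇔faceProduct≈ε h) (faces h))

    closed⇒∑faceFlux≈ε : (∀ e → ExactlyTwoSides (toCx S) e) → sum faceFlux ≈ ε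
    closed⇒∑faceFlux≈ε interior =
      trans (∑faceFlux≈∑edgeFlux (inj₂ ∘ interior)) (sum-≈ε {f = edgeFlux ∘ inj₂ ∘ interior} (λ _ → ≈-refl))

    ∑faceFlux≈∑boundaryFlux : (bd : ∀ e → ExactlyOneSide (toCx S) e ⊎ ExactlyTwoSides (toCx S) e) →
                              ∀ {k} (bc : BoundaryCover S (suc k)) →
                              sum faceFlux ≈ sum (λ i → u (inducedOE (BoundaryCycle.boundarySide S bc i)))
    ∑faceFlux≈∑boundaryFlux bd bc = trans (∑faceFlux≈∑edgeFlux bd)
      (sym (trans (sum-cong-≋ (λ i → onBoundary i (bd (proj₁ (β i)))))
                  (sum-reindex (proj₁ ∘ β) (edgeFlux ∘ bd) β-edge-injective covers)))
      where
      open BoundaryCover bc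
      open BoundaryCycle S bc
      onBoundary : ∀ i (r : ExactlyOneSide (toCx S) (proj₁ (β i)) ⊎ ExactlyTwoSides (toCx S) (proj₁ (β i))) →
                   u (inducedOE (boundarySide i)) ≈ edgeFlux r
      onBoundary i (inj₁ (σ , σ-on , _)) =
        reflexive (cong (u ∘ inducedOE) (≡.sym (proj₂ (proj₂ (β-bd i)) σ σ-on)))
      onBoundary i (inj₂ (σ , τ , σ≢τ , σ-on , τ-on , _)) =
        contradiction (≡.trans (proj₂ (proj₂ (β-bd i)) σ σ-on) (≡.sym (proj₂ (proj₂ (β-bd i)) τ τ-on))) σ≢τ
      covers : ∀ e → (∃ λ i → proj₁ (β i) ≡ e) ⊎ edgeFlux (bd e) ≈ ε
      covers e with bd e
      ... | inj₁ one = inj₁ (β-all e one)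
      ... | inj₂ _   = inj₂ ≈-refl

  module Coherence (wf : WellFormed (toCx S))
    (bd : ∀ e → ExactlyOneSide (toCx S) e ⊎ ExactlyTwoSides (toCx S) e)
    {k : ℕ} (bc : BoundaryCover S (suc k)) where
    open BoundaryCover bc
    open BoundaryCycle S bc
    open MonoidSums ℤ.+-0-commutativeMonoid using (sum; sum-cong-≗; when; when-yes; when-≈ε; sum-support₂)

    agrees : Fin (3 ℕ.* suc k) → Bool
    agrees i = does (proj₂ (β i) Bool.≟ induced (toCx S) (proj₁ o) (boundarySide i))

    inducedOE-boundarySide : ∀ i →
      inducedOE (boundarySide i) ≡ (proj₁ (β i) , induced (toCx S) (proj₁ o) (boundarySide i))
    inducedOE-boundarySide i = cong (_, induced (toCx S) (proj₁ o) (boundarySide i)) (proj₁ (proj₂ (β-bd i)))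

    inducedOE-boundarySide-reorient : ∀ i → inducedOE (boundarySide i) ≡ reorient (agrees i) (β i)
    inducedOE-boundarySide-reorient i =
      ≡.trans (inducedOE-boundarySide i) (reorient-toward (proj₁ (β i)) (proj₂ (β i)) _)

    signed-boundary-coboundary : ∀ φ →
      sum (λ j → signed (agrees j) (Coboundary.coboundary (toCx S) φ (β j))) ≡ ℤ.+ 0
    signed-boundary-coboundary φ = begin
      sum (λ j → signed (agrees j) (coboundary (β j)))     ≡⟨ sum-cong-≗ flux-β ⟨
      sum (λ j → coboundary (inducedOE (boundarySide j)))  ≡⟨ ∑faceFlux≈∑boundaryFlux bd bc ⟨
      sum faceFlux                                         ≡⟨ ∑faceFlux≈ε-from-faces (coboundary-face wf) ⟩
      ℤ.+ 0                                                ∎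
      where
      open ≡-Reasoning
      open Coboundary (toCx S) φ
      open Flux ℤ.+-0-commutativeMonoid coboundary coboundary-rev
      flux-β : ∀ j → coboundary (inducedOE (boundarySide j)) ≡ signed (agrees j) (coboundary (β j))
      flux-β j = ≡.trans (cong coboundary (inducedOE-boundarySide-reorient j)) (coboundary-reorient (agrees j) (β j))

    -- The coboundary of the indicator of the vertex where β i ends and β (i+1)
    -- starts is +1 on β i, −1 on β (i+1) and 0 on every other boundary edge.
    agrees-step : ∀ i → agrees (cycSuc i) ≡ agrees i
    agrees-step i = ≡.sym (signed-cancel (agrees i) (agrees i′) (begin
      signed (agrees i) (ℤ.+ 1) ℤ.+ signed (agrees i′) (ℤ.- ℤ.+ 1)
        ≡⟨ cong₂ ℤ._+_ (cong (signed (agrees i)) cb-βᵢ) (cong (signed (agrees i′)) cb-βᵢ′) ⟨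
      term i ℤ.+ term i′
        ≡⟨ sum-support₂ (cycSuc≢id i ∘ ≡.sym) term-other ⟨
      sum term
        ≡⟨ signed-boundary-coboundary δ ⟩
      ℤ.+ 0 ∎))
      where
      open ≡-Reasoning
      i′ = cycSuc i
      v = s (β i′)
      δ : Fin (FinCx.nV S) → ℤ
      δ x = when (x Fin.≟ v) (ℤ.+ 1)
      open Coboundary (toCx S) δ

      δ-v : δ v ≡ ℤ.+ 1
      δ-v = when-yes refl (v Fin.≟ v)
      δ-s : ∀ j → j ≢ i′ → δ (s (β j)) ≡ ℤ.+ 0
      δ-s j j≢i′ = when-≈ε (λ sⱼ≡v → contradiction (β-inj j i′ sⱼ≡v) j≢i′) (s (β j) Fin.≟ v)
      δ-t : ∀ j → j ≢ i → δ (t (β j)) ≡ ℤ.+ 0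
      δ-t j j≢i rewrite β-chain j = δ-s (cycSuc j) (j≢i ∘ cycSuc-injective)

      cb-βᵢ : coboundary (β i) ≡ ℤ.+ 1
      cb-βᵢ = cong₂ ℤ._-_ (≡.trans (cong δ (β-chain i)) δ-v) (δ-s i (cycSuc≢id i ∘ ≡.sym))
      cb-βᵢ′ : coboundary (β i′) ≡ ℤ.- ℤ.+ 1
      cb-βᵢ′ = cong₂ ℤ._-_ (δ-t i′ (cycSuc≢id i)) δ-v

      term : Fin (3 ℕ.* suc k) → ℤ
      term j = signed (agrees j) (coboundary (β j))
      term-other : ∀ j → j ≢ i → j ≢ i′ → term j ≡ ℤ.+ 0
      term-other j j≢i j≢i′ rewrite δ-t j j≢i | δ-s j j≢i′ with agrees j
      ... | true  = refl
      ... | false = refl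

    agrees-constant : ∀ i → agrees i ≡ agrees zero
    agrees-constant = cycSuc-invariant⇒constant agrees agrees-step

module FieldProperties {c ℓ} (K : Field c ℓ) where
  open Field K renaming (refl to ≈-refl) hiding (zero)
  -- from here on `sum` is the iterated product of the multiplicative monoid
  open MonoidSums *-commutativeMonoid
  open import Algebra.Solver.CommutativeMonoid *-commutativeMonoid using (solve; _⊕_; _⊜_; id)
  open import Relation.Binary.Reasoning.Setoid setoid

  pow-≈1 : ∀ {x} m → x ≈ 1# → pow K x m ≈ 1#
  pow-≈1 zero    x≈1 = ≈-refl
  pow-≈1 (suc m) x≈1 = trans (*-cong x≈1 (pow-≈1 m x≈1)) (*-identityˡ 1#)

  ≈1⇔pow≈1 : ∀ {k x} → TorsionCoprime K k → ¬ x ≈ 0# → (x ≈ 1# ⇔ pow K x k ≈ 1#)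
  ≈1⇔pow≈1 {k} (_ , torsion-free) x≉0 = mk⇔ (pow-≈1 k) (torsion-free _ x≉0)

  *-≉0 : ∀ {x y} → ¬ x ≈ 0# → ¬ y ≈ 0# → ¬ (x * y) ≈ 0#
  *-≉0 {x} {y} x≉0 y≉0 xy≈0 = y≉0 (begin
    y              ≈⟨ *-identityˡ y ⟨
    1# * y         ≈⟨ *-congʳ (trans (*-comm x′ x) x*x′≈1) ⟨
    (x′ * x) * y   ≈⟨ *-assoc x′ x y ⟩
    x′ * (x * y)   ≈⟨ *-congˡ xy≈0 ⟩
    x′ * 0#        ≈⟨ zeroʳ x′ ⟩
    0#             ∎)
    where
    x′ = proj₁ (inverse x x≉0)
    x*x′≈1 = proj₂ (inverse x x≉0)

  sum-≉0 : ∀ {n} {g : Fin n → Carrier} → (∀ i → ¬ g i ≈ 0#) → ¬ sum g ≈ 0#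
  sum-≉0 {zero}  g≉0 = 1≉0
  sum-≉0 {suc n} g≉0 = *-≉0 (g≉0 zero) (sum-≉0 (g≉0 ∘ suc))

  orbit-product : (g : Fin 3 → Carrier) → ∀ d a → g a * (g (turn d a) * g (turn d (turn d a))) ≈ sum g
  orbit-product g true  zero             = solve 3 (λ x y z → x ⊕ (y ⊕ z) ⊜ x ⊕ (y ⊕ (z ⊕ id))) ≈-refl _ _ _
  orbit-product g true  (suc zero)       = solve 3 (λ x y z → y ⊕ (z ⊕ x) ⊜ x ⊕ (y ⊕ (z ⊕ id))) ≈-refl _ _ _
  orbit-product g true  (suc (suc zero)) = solve 3 (λ x y z → z ⊕ (x ⊕ y) ⊜ x ⊕ (y ⊕ (z ⊕ id))) ≈-refl _ _ _
  orbit-product g false zero             = solve 3 (λ x y z → x ⊕ (z ⊕ y) ⊜ x ⊕ (y ⊕ (z ⊕ id))) ≈-refl _ _ _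
  orbit-product g false (suc zero)       = solve 3 (λ x y z → y ⊕ (x ⊕ z) ⊜ x ⊕ (y ⊕ (z ⊕ id))) ≈-refl _ _ _
  orbit-product g false (suc (suc zero)) = solve 3 (λ x y z → z ⊕ (y ⊕ x) ⊜ x ⊕ (y ⊕ (z ⊕ id))) ≈-refl _ _ _

  sum-turn-walk : (g : Fin 3 → Carrier) → ∀ d m a →
                  sum {3 ℕ.* m} (λ i → g (fold a (turn d) (toℕ i))) ≈ pow K (sum g) m
  sum-turn-walk g d zero    a = ≈-refl
  sum-turn-walk g d (suc m) a = begin
    sum {3 ℕ.* suc m} (walk ∘ toℕ)
      ≡⟨ cong (λ n → sum {n} (walk ∘ toℕ)) (ℕ.*-suc 3 m) ⟩
    walk 0 * (walk 1 * (walk 2 * sum {3 ℕ.* m} (λ i → walk (3 ℕ.+ toℕ i))))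
      ≈⟨ solve 4 (λ x y z w → x ⊕ (y ⊕ (z ⊕ w)) ⊜ (x ⊕ (y ⊕ z)) ⊕ w) ≈-refl _ _ _ _ ⟩
    (walk 0 * (walk 1 * walk 2)) * sum {3 ℕ.* m} (λ i → walk (3 ℕ.+ toℕ i))
      ≈⟨ *-cong (orbit-product g d a) (reflexive (sum-cong-≗ {3 ℕ.* m} (cong g ∘ turn³ d ∘ fold a (turn d) ∘ toℕ))) ⟩
    sum g * sum {3 ℕ.* m} (walk ∘ toℕ)
      ≈⟨ *-congˡ (sum-turn-walk g d m a) ⟩
    sum g * pow K (sum g) m ∎
    where
    walk : ℕ → Carrier
    walk j = g (fold a (turn d) j)

-- Faces of a glued complex carry proofs g ≢ f, so their equality is not decidable;
-- this weaker decidability is what the induction needs and can maintain.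
DistinguishableFaces : Cx → Set
DistinguishableFaces X = ∀ g h → (∀ i → Cx.side X g i ≡ Cx.side X h i) ⊎ g ≢ h

module GluingStep {c ℓ} (K : Field c ℓ) (Y : Cx) (f : Cx.F Y) (S : FinCx)
  (wf : WellFormed (toCx S)) (o : Orientable (toCx S))
  (bd : ∀ e → ExactlyOneSide (toCx S) e ⊎ ExactlyTwoSides (toCx S) e)
  {k : ℕ} (bc : BoundaryCover S (suc k)) where
  open Field K renaming (refl to ≈-refl) hiding (zero)
  open FieldProperties K
  open MonoidSums *-commutativeMonoid
  open Glue Y f S (suc k) bc
  open BoundaryCover bc
  open BoundaryCycle S bc
  open CoveringDirection φ φ-cover
  open OrientedEdges Y
  private
    module Y = Cx Y
    module S = Cx (toCx S)
    module G = Cx glued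

  orientAs-reorient : ∀ b b′ a → orientAs b b′ a ≡ reorient (does (b Bool.≟ b′)) a
  orientAs-reorient b b′ a with b Bool.≟ b′
  ... | yes _ = refl
  ... | no _  = refl

  orientAs-not : ∀ b b′ a → orientAs b (not b′) a ≡ Y.rev (orientAs b b′ a)
  orientAs-not true  true  a = refl
  orientAs-not true  false a = ≡.sym (rev-involutive a)
  orientAs-not false true  a = ≡.sym (rev-involutive a)
  orientAs-not false false a = refl

  embOE-rev : ∀ x → embOE (S.rev x) ≡ G.rev (embOE x)
  embOE-rev (e , b′) with Fin.any? (λ i → proj₁ (β i) Fin.≟ e)
  ... | yes (i , _) = cong liftY (orientAs-not (proj₂ (β i)) b′ (img i))
  ... | no _        = refl

  embOE-boundary : ∀ i b′ → embOE (proj₁ (β i) , b′) ≡ liftY (orientAs (proj₂ (β i)) b′ (img i))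
  embOE-boundary i b′ with Fin.any? (λ j → proj₁ (β j) Fin.≟ proj₁ (β i))
  ... | no none = contradiction (i , refl) none
  ... | yes (j , same) with β-edge-injective j i same
  ...   | refl = refl

  img≡sideFrom : ∀ i → img i ≡ sideFrom f (does (φ (cycSuc i) Fin.≟ next (φ i))) (φ i)
  img≡sideFrom i with φ (cycSuc i) Fin.≟ next (φ i) | ≢⇒next⊎prev (proj₁ (φ-cover i))
  ... | yes _       | _           = refl
  ... | no b≢next   | inj₁ b≡next = contradiction b≡next b≢next
  ... | no _        | inj₂ b≡prev = cong (Y.rev ∘ Y.side f) b≡prev

  -- the boundary of S winds suc k times around the triangle f
  img-walk : ∀ i → img i ≡ sideFrom f (direction zero) (fold (φ zero) (turn (direction zero)) (toℕ i))
  img-walk i = ≡.trans (img≡sideFrom i)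
    (cong₂ (sideFrom f) (direction-constant i) (cycSuc-walk (turn (direction zero)) φ φ-turn i))

  module WithCochain (U : G.OE → Carrier) (U-rev : ∀ a → U a * U (G.rev a) ≈ 1#) where
    UY : Y.OE → Carrier
    UY = U ∘ liftY

    u : S.OE → Carrier
    u = U ∘ embOE

    u-rev : ∀ x → u x * u (S.rev x) ≈ 1#
    u-rev x = trans (*-congˡ (reflexive (cong U (embOE-rev x)))) (U-rev (embOE x))

    open OrientedSurface S o
    open Flux *-commutativeMonoid u u-rev public
    open Coherence wf bd bc
    module ∂f = Cochain *-commutativeMonoid Y UY (U-rev ∘ liftY)

    d : Bool
    d = direction zero

    u-boundary : ∀ i → u (inducedOE (boundarySide i)) ≡ UY (reorient (agrees zero) (img i))
    u-boundary i = cong U (begin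
      embOE (inducedOE (boundarySide i))         ≡⟨ cong embOE (inducedOE-boundarySide i) ⟩
      embOE (proj₁ (β i) , dᵢ)                   ≡⟨ embOE-boundary i dᵢ ⟩
      liftY (orientAs (proj₂ (β i)) dᵢ (img i))  ≡⟨ cong liftY (orientAs-reorient (proj₂ (β i)) dᵢ (img i)) ⟩
      liftY (reorient (agrees i) (img i))        ≡⟨ cong (λ b → liftY (reorient b (img i))) (agrees-constant i) ⟩
      liftY (reorient (agrees zero) (img i))     ∎)
      where
      open ≡-Reasoning
      dᵢ = induced (toCx S) (proj₁ o) (boundarySide i)

    ∑img≈pow : sum (UY ∘ img) ≈ pow K (sum (UY ∘ sideFrom f d)) (suc k)
    ∑img≈pow = trans (reflexive (sum-cong-≗ (cong UY ∘ img-walk)))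
                     (sum-turn-walk (UY ∘ sideFrom f d) d (suc k) (φ zero))

    ∑faceFlux≈1⇔∂f≈1 : TorsionCoprime K (suc k) → (∀ a → ¬ UY a ≈ 0#) →
                       (sum faceFlux ≈ 1# ⇔ ∂f.faceProduct f ≈ 1#)
    ∑faceFlux≈1⇔∂f≈1 tc UY≉0 = begin
      sum faceFlux ≈ 1#                              ≈⟨ ≈⇒≈ε⇔ (∑faceFlux≈∑boundaryFlux bd bc) ⟩
      sum (u ∘ inducedOE ∘ boundarySide) ≈ 1#        ≈⟨ ≈⇒≈ε⇔ (reflexive (sum-cong-≗ u-boundary)) ⟩
      sum (UY ∘ reorient (agrees zero) ∘ img) ≈ 1#   ≈⟨ ∂f.sum-reorient≈ε⇔ (agrees zero) img ⟩
      sum (UY ∘ img) ≈ 1#                            ≈⟨ ≈⇒≈ε⇔ ∑img≈pow ⟩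
      pow K (sum (UY ∘ sideFrom f d)) (suc k) ≈ 1#   ≈⟨ ≈1⇔pow≈1 tc (sum-≉0 (UY≉0 ∘ sideFrom f d)) ⟨
      sum (UY ∘ sideFrom f d) ≈ 1#                   ≈⟨ ∂f.sum-sideFrom≈ε⇔ f d ⟩
      ∂f.faceProduct f ≈ 1#                          ∎
      where open import Relation.Binary.Reasoning.Setoid (⇔-setoid ℓ)

  faceOfY : G.F → Y.F
  faceOfY (inj₁ (g , _)) = g
  faceOfY (inj₂ _)       = f

  excisable : TorsionCoprime K (suc k) → (∀ g → Excisable K Y g) → DistinguishableFaces Y →
              ∀ f₀ → Excisable K glued f₀
  excisable tc excY _ (inj₂ h₀) U U≉0 U-rev faces =
    faceProduct≈ε-from-others h₀ (Equivalence.from (∑faceFlux≈1⇔∂f≈1 tc (U≉0 ∘ liftY)) ∂f≈1)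
                              (λ h h≢h₀ → faces (inj₂ h) (h≢h₀ ∘ inj₂-injective))
    where
    open WithCochain U U-rev
    ∂f≈1 : ∂f.faceProduct f ≈ 1#
    ∂f≈1 = excY f UY (U≉0 ∘ liftY) (U-rev ∘ liftY) (λ g g≢f → faces (inj₁ (g , g≢f)) λ ())
  excisable tc excY distY (inj₁ (g₀ , _)) U U≉0 U-rev faces =
    excY g₀ UY (U≉0 ∘ liftY) (U-rev ∘ liftY) facesY
    where
    open WithCochain U U-rev
    ∂f≈1 : ∂f.faceProduct f ≈ 1#
    ∂f≈1 = Equivalence.to (∑faceFlux≈1⇔∂f≈1 tc (U≉0 ∘ liftY))
                          (∑faceFlux≈ε-from-faces (λ h → faces (inj₂ h) λ ()))
    facesY : ∀ g → g ≢ g₀ → ∂f.faceProduct g ≈ 1#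
    facesY g g≢g₀ with distY g f
    ... | inj₁ same = trans (reflexive (∂f.faceProduct-cong same)) ∂f≈1
    ... | inj₂ g≢f  = faces (inj₁ (g , g≢f)) (g≢g₀ ∘ cong faceOfY)

  distinguishable : DistinguishableFaces Y → DistinguishableFaces glued
  distinguishable distY (inj₁ (g , _)) (inj₁ (h , _)) with distY g h
  ... | inj₁ same = inj₁ (cong liftY ∘ same)
  ... | inj₂ g≢h  = inj₂ (g≢h ∘ cong faceOfY)
  distinguishable distY (inj₁ _) (inj₂ _) = inj₂ λ ()
  distinguishable distY (inj₂ _) (inj₁ _) = inj₂ λ ()
  distinguishable distY (inj₂ a) (inj₂ b) with a Fin.≟ b
  ... | yes refl = inj₁ λ _ → refl
  ... | no a≢b   = inj₂ (a≢b ∘ inj₂-injective)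

finCx-distinguishable : ∀ S → DistinguishableFaces (toCx S)
finCx-distinguishable S g h with g Fin.≟ h
... | yes refl = inj₁ λ _ → refl
... | no g≢h   = inj₂ g≢h

closedSurface-excisable : ∀ {c ℓ} (K : Field c ℓ) S → ClosedOrientableSurface (toCx S) →
                          ∀ f₀ → Excisable K (toCx S) f₀
closedSurface-excisable K S (_ , _ , o , interior , _) f₀ U _ U-rev faces =
  faceProduct≈ε-from-others f₀ (closed⇒∑faceFlux≈ε interior) faces
  where
  open OrientedSurface S o
  open Flux (Field.*-commutativeMonoid K) U U-rev

grope-excisable : ∀ {c ℓ} (K : Field c ℓ) {q X} → IsGrope K q X →
                  (∀ f → Excisable K X f) × DistinguishableFaces X
grope-excisable K (base S closed) = closedSurface-excisable K S closed , finCx-distinguishable S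
grope-excisable K (step _ _ _ _ zero (() , _) _)
grope-excisable K (step grope f S (wf , _ , o , bd , _) (suc k) tc bc) =
  excisable tc excY distY , distinguishable distY
  where
  open GluingStep K _ f S wf o bd bc
  excY = proj₁ (grope-excisable K grope)
  distY = proj₂ (grope-excisable K grope)

proposition4p21 : ∀ {c ℓ : Level} (K : Field c ℓ) (q : ℕ) (X : Cx) →
    IsGrope K q X → (f : Cx.F X) → Excisable K X f
proposition4p21 K q X grope = proj₁ (grope-excisable K grope)
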